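{- Let $n \ge 6$ with $n \equiv 0 \pmod 6$ and let $m \ge 3$. Then $\gamma_{r2}(C_{m} \Box C_n) \leq \left\lceil \frac{m}{3} \right\rceil n$.
   Context: A 2-rainbow dominating function (2RDF) of a graph $G$ assigns to each vertex a subset of $\{1,2\}$ so that every vertex $v$ with $f(v)=\emptyset$ satisfies $\bigcup_{u\in N(v)} f(u)=\{1,2\}$; its weight is $\sum_v |f(v)|$ and $\gamma_{r2}(G)$ is the minimum weight of a 2RDF of $G$. $C_m \Box C_n$ is the Cartesian product of the cycles $C_m$ and $C_n$. -}

module Defs where

open import Data.Nat using (ℕ; zero; suc; _+_; _*_; _≤_; NonZero)
open import Data.Nat.DivMod using (_%_; _/_)
open import Data.Bool using (Bool; true; false)
open import Data.Fin using (Fin; toℕ)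
open import Data.Product using (_×_; _,_; Σ; ∃-syntax)
open import Data.Sum using (_⊎_)
open import Data.List using (List; map; allFin; cartesianProduct)
open import Data.Nat.ListAction using (sum)
open import Relation.Binary.PropositionalEquality using (_≡_)

record Graph : Set₁ where
  field
    V   : Set
    Adj : V → V → Set

-- Subsets of {1,2}: (1 ∈ S, 2 ∈ S).
Label : Set
Label = Bool × Bool

size : Label → ℕ
size (false , false) = 0
size (true  , false) = 1
size (false , true ) = 1
size (true  , true ) = 2

has1 : Label → Bool
has1 (a , _) = a

has2 : Label → Bool
has2 (_ , b) = b

Is2RDF : (G : Graph) → (Graph.V G → Label) → Set
Is2RDF G f = ∀ v → f v ≡ (false , false) →
  (∃[ u ] (Adj u v × has1 (f u) ≡ true)) × (∃[ u ] (Adj u v × has2 (f u) ≡ true))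
  where open Graph G

CycAdj : (m : ℕ) → .{{NonZero m}} → Fin m → Fin m → Set
CycAdj m i j = (toℕ j ≡ suc (toℕ i) % m) ⊎ (toℕ i ≡ suc (toℕ j) % m)

CycleProd : (m n : ℕ) → .{{NonZero m}} → .{{NonZero n}} → Graph
CycleProd m n = record
  { V   = Fin m × Fin n
  ; Adj = λ { (i , j) (i' , j') →
              (i ≡ i' × CycAdj n j j') ⊎ (j ≡ j' × CycAdj m i i') } }

weight : (m n : ℕ) → (Fin m × Fin n → Label) → ℕ
weight m n f = sum (map (λ v → size (f v)) (cartesianProduct (allFin m) (allFin n)))

γr2≤ : (m n : ℕ) → .{{_ : NonZero m}} → .{{_ : NonZero n}} → ℕ → Set
γr2≤ m n b = Σ (Fin m × Fin n → Label) λ f → Is2RDF (CycleProd m n) f × weight m n f ≤ b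

ceil3 : ℕ → ℕ
ceil3 a = (a + 2) / 3

{-# OPTIONS --safe #-}
-- Label the cell (i, j) iff j mod 3 lies in a set Sᵢ ⊆ ℤ₃, with {1} or {2} according to
-- the parity of j; since 6 ∣ n both residues are consistent around C_n. An unlabelled cell
-- (i, j) gets the colour of j from the cell above or below it as soon as
-- Sᵢ₋₁ ∪ Sᵢ ∪ Sᵢ₊₁ = ℤ₃, and the other colour from a labelled cell of its own row as soon
-- as Sᵢ ≠ ∅, because the other two residues mod 3 are those of j ± 1. The sets
-- Sᵢ = {i mod 3}, with row 0 enlarged so that the pattern closes up around C_m, have total
-- size 3⌈m/3⌉, so the weight is (n/3) · 3⌈m/3⌉.
module Submission where

open import Defs
open import Data.Bool using (Bool; true; false; T; _∧_; _∨_; if_then_else_)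
open import Data.Bool.Properties using (T-∧; T-∨)
open import Data.Empty using (⊥-elim)
open import Data.Fin using (Fin; zero; suc; toℕ; fromℕ; fromℕ<; inject₁)
open import Data.Fin.Properties using (toℕ<n; toℕ-fromℕ; toℕ-fromℕ<; toℕ-inject₁)
open import Data.List
  using (List; []; _∷_; _++_; map; allFin; tabulate; applyUpTo; cartesianProduct)
open import Data.List.Properties using (map-++; map-∘; map-cong; map-tabulate)
open import Data.Nat using (ℕ; zero; suc; _+_; _*_; _≤_; _<_; _%_; s≤s; z≤n; NonZero; parity)
open import Data.Nat.DivMod using (m%n<n; m<n⇒m%n≡m; n%n≡0; +-distrib-/-∣ˡ)
open import Data.Nat.Divisibility using (_∣_; divides; divides-refl; ∣-refl; ∣-trans; m%n≡0⇒n∣m)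
open import Data.Nat.ListAction using (sum)
open import Data.Nat.ListAction.Properties using (sum-++)
open import Data.Nat.Properties
  using (≤-reflexive; m≤n⇒m<n∨m≡n; suc-injective; +-comm; *-zeroʳ; *-suc; *-identityʳ; *-distribˡ-+)
open import Data.Nat.Tactic.RingSolver using (solve-∀)
open import Data.Parity using (Parity; 0ℙ; 1ℙ; _⁻¹)
import Data.Parity.Properties as ℙ
open import Data.Product using (_×_; _,_; proj₁; proj₂; ∃-syntax)
open import Data.Sum using (_⊎_; inj₁; inj₂; map₂)
open import Function using (_∘_; id)
open import Function.Bundles using (Equivalence)
open import Relation.Nullary using (¬_)
open import Relation.Binary.PropositionalEquality
  using (_≡_; refl; sym; trans; cong; cong₂; subst; module ≡-Reasoning)

open Equivalence using (to)

data ℤ₃ : Set where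
  0₃ 1₃ 2₃ : ℤ₃

suc₃ : ℤ₃ → ℤ₃
suc₃ 0₃ = 1₃
suc₃ 1₃ = 2₃
suc₃ 2₃ = 0₃

residue₃ : ℕ → ℤ₃
residue₃ 0 = 0₃
residue₃ 1 = 1₃
residue₃ 2 = 2₃
residue₃ (suc (suc (suc x))) = residue₃ x

residue₃-suc : ∀ x → residue₃ (suc x) ≡ suc₃ (residue₃ x)
residue₃-suc 0 = refl
residue₃-suc 1 = refl
residue₃-suc 2 = refl
residue₃-suc (suc (suc (suc x))) = residue₃-suc x

residue₃-∣ : ∀ {x} → 3 ∣ x → residue₃ x ≡ 0₃
residue₃-∣ (divides-refl q) = residue₃-*3 q
  where
  residue₃-*3 : ∀ q → residue₃ (q * 3) ≡ 0₃
  residue₃-*3 zero = refl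
  residue₃-*3 (suc q) = residue₃-*3 q

orbit-suc₃ : ∀ r a → a ≡ r ⊎ a ≡ suc₃ r ⊎ a ≡ suc₃ (suc₃ r)
orbit-suc₃ 0₃ 0₃ = inj₁ refl
orbit-suc₃ 1₃ 1₃ = inj₁ refl
orbit-suc₃ 2₃ 2₃ = inj₁ refl
orbit-suc₃ 0₃ 1₃ = inj₂ (inj₁ refl)
orbit-suc₃ 1₃ 2₃ = inj₂ (inj₁ refl)
orbit-suc₃ 2₃ 0₃ = inj₂ (inj₁ refl)
orbit-suc₃ 0₃ 2₃ = inj₂ (inj₂ refl)
orbit-suc₃ 1₃ 0₃ = inj₂ (inj₂ refl)
orbit-suc₃ 2₃ 1₃ = inj₂ (inj₂ refl)

Subset₃ : Set
Subset₃ = ℤ₃ → Bool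

_∈₃_ : ℤ₃ → Subset₃ → Set
a ∈₃ S = T (S a)

⁅_⁆ : ℤ₃ → Subset₃
⁅ 0₃ ⁆ 0₃ = true
⁅ 1₃ ⁆ 1₃ = true
⁅ 2₃ ⁆ 2₃ = true
⁅ _ ⁆ _ = false

∈⁅⁆ : ∀ r → r ∈₃ ⁅ r ⁆
∈⁅⁆ 0₃ = _
∈⁅⁆ 1₃ = _
∈⁅⁆ 2₃ = _

indicator : Bool → ℕ
indicator false = 0
indicator true = 1

∣_∣ : Subset₃ → ℕ
∣ S ∣ = indicator (S 0₃) + indicator (S 1₃) + indicator (S 2₃)

∣⁅⁆∣ : ∀ r → ∣ ⁅ r ⁆ ∣ ≡ 1
∣⁅⁆∣ 0₃ = refl
∣⁅⁆∣ 1₃ = refl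
∣⁅⁆∣ 2₃ = refl

Covers : Subset₃ → Subset₃ → Subset₃ → Set
Covers A B C = ∀ a → a ∈₃ A ⊎ a ∈₃ B ⊎ a ∈₃ C

all₃ : (ℤ₃ → Bool) → Bool
all₃ p = p 0₃ ∧ p 1₃ ∧ p 2₃

all₃-sound : ∀ p → T (all₃ p) → ∀ a → T (p a)
all₃-sound p h 0₃ = proj₁ (to (T-∧ {p 0₃}) h)
all₃-sound p h 1₃ = proj₁ (to (T-∧ {p 1₃}) (proj₂ (to (T-∧ {p 0₃}) h)))
all₃-sound p h 2₃ = proj₂ (to (T-∧ {p 1₃}) (proj₂ (to (T-∧ {p 0₃}) h)))

covers? : Subset₃ → Subset₃ → Subset₃ → Bool
covers? A B C = all₃ (λ a → A a ∨ B a ∨ C a)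

covers?-sound : ∀ {A B C} → T (covers? A B C) → Covers A B C
covers?-sound {A} {B} {C} h a =
  map₂ (to (T-∨ {B a})) (to (T-∨ {A a}) (all₃-sound (λ a → A a ∨ B a ∨ C a) h a))

Covers-cong : ∀ (S : ℕ → Subset₃) {x y z x′ y′ z′} → x ≡ x′ → y ≡ y′ → z ≡ z′ →
  Covers (S x′) (S y′) (S z′) → Covers (S x) (S y) (S z)
Covers-cong S refl refl refl c = c

orbit-covers : ∀ {A B C} r → r ∈₃ A → suc₃ r ∈₃ B → suc₃ (suc₃ r) ∈₃ C → Covers A B C
orbit-covers r r∈A r+1∈B r+2∈C a with orbit-suc₃ r a
... | inj₁ refl = inj₁ r∈A
... | inj₂ (inj₁ refl) = inj₂ (inj₁ r+1∈B)
... | inj₂ (inj₂ refl) = inj₂ (inj₂ r+2∈C)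

next : ∀ {k} → Fin (suc k) → Fin (suc k)
next {k} i = fromℕ< (m%n<n (suc (toℕ i)) (suc k))

prev : ∀ {k} → Fin (suc k) → Fin (suc k)
prev {k} zero = fromℕ k
prev (suc i) = inject₁ i

toℕ-next : ∀ {k} (i : Fin (suc k)) → toℕ (next i) ≡ suc (toℕ i) % suc k
toℕ-next {k} i = toℕ-fromℕ< (m%n<n (suc (toℕ i)) (suc k))

toℕ-next-prev : ∀ {k} (i : Fin (suc k)) → toℕ i ≡ suc (toℕ (prev i)) % suc k
toℕ-next-prev {k} zero =
  trans (sym (n%n≡0 (suc k))) (cong (λ x → suc x % suc k) (sym (toℕ-fromℕ k)))
toℕ-next-prev {k} (suc i) =
  trans (sym (m<n⇒m%n≡m (s≤s (toℕ<n i)))) (cong (λ x → suc x % suc k) (sym (toℕ-inject₁ i)))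

next-adjacent : ∀ {k} (i : Fin (suc k)) → CycAdj (suc k) (next i) i
next-adjacent i = inj₂ (toℕ-next i)

prev-adjacent : ∀ {k} (i : Fin (suc k)) → CycAdj (suc k) (prev i) i
prev-adjacent i = inj₁ (toℕ-next-prev i)

toℕ-next-< : ∀ {k} (i : Fin (suc k)) → suc (toℕ i) < suc k → toℕ (next i) ≡ suc (toℕ i)
toℕ-next-< i lt = trans (toℕ-next i) (m<n⇒m%n≡m lt)

toℕ-next-last : ∀ {k} (i : Fin (suc k)) → suc (toℕ i) ≡ suc k → toℕ (next i) ≡ 0
toℕ-next-last {k} i eq = trans (toℕ-next i) (trans (cong (_% suc k) eq) (n%n≡0 (suc k)))

module _ {A : Set} (r : ℕ → A) (σ : A → A) (r-suc : ∀ x → r (suc x) ≡ σ (r x))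
         {k : ℕ} (r-period : r (suc k) ≡ r 0) where

  periodic-suc-% : ∀ {x} → x < suc k → r (suc x % suc k) ≡ σ (r x)
  periodic-suc-% {x} x<n with m≤n⇒m<n∨m≡n x<n
  ... | inj₁ 1+x<n = trans (cong r (m<n⇒m%n≡m 1+x<n)) (r-suc x)
  ... | inj₂ 1+x≡n = begin
    r (suc x % suc k)  ≡⟨ cong (λ y → r (y % suc k)) 1+x≡n ⟩
    r (suc k % suc k)  ≡⟨ cong r (n%n≡0 (suc k)) ⟩
    r 0                ≡⟨ sym r-period ⟩
    r (suc k)          ≡⟨ cong r (sym 1+x≡n) ⟩
    r (suc x)          ≡⟨ r-suc x ⟩
    σ (r x)            ∎
    where open ≡-Reasoning

  periodic-next : ∀ i → r (toℕ (next i)) ≡ σ (r (toℕ i))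
  periodic-next i = trans (cong r (toℕ-next i)) (periodic-suc-% (toℕ<n i))

  periodic-prev : ∀ i → r (toℕ i) ≡ σ (r (toℕ (prev i)))
  periodic-prev i = trans (cong r (toℕ-next-prev i)) (periodic-suc-% (toℕ<n (prev i)))

parity-suc : ∀ x → parity (suc x) ≡ parity x ⁻¹
parity-suc x = sym (ℙ.⁻¹-selfInverse (ℙ.suc-homo-⁻¹ x))

parity-∣ : ∀ {x} → 2 ∣ x → parity x ≡ 0ℙ
parity-∣ (divides-refl q) = trans (ℙ.*-homo-* q 2) (ℙ.*-zeroʳ (parity q))

residue₃-next : ∀ {l} → 3 ∣ suc l → (j : Fin (suc l)) →
  residue₃ (toℕ (next j)) ≡ suc₃ (residue₃ (toℕ j))
residue₃-next 3∣n = periodic-next residue₃ suc₃ residue₃-suc (residue₃-∣ 3∣n)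

residue₃-prev : ∀ {l} → 3 ∣ suc l → (j : Fin (suc l)) →
  residue₃ (toℕ j) ≡ suc₃ (residue₃ (toℕ (prev j)))
residue₃-prev 3∣n = periodic-prev residue₃ suc₃ residue₃-suc (residue₃-∣ 3∣n)

parity-next : ∀ {l} → 2 ∣ suc l → (j : Fin (suc l)) →
  parity (toℕ (next j)) ≡ parity (toℕ j) ⁻¹
parity-next 2∣n = periodic-next parity _⁻¹ parity-suc (parity-∣ 2∣n)

parity-prev : ∀ {l} → 2 ∣ suc l → (j : Fin (suc l)) →
  parity (toℕ (prev j)) ≡ parity (toℕ j) ⁻¹
parity-prev 2∣n j =
  sym (ℙ.⁻¹-selfInverse (sym (periodic-prev parity _⁻¹ parity-suc (parity-∣ 2∣n) j)))

sum-cartesianProduct : ∀ {A B : Set} (h : A × B → ℕ) (xs : List A) (ys : List B) →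
  sum (map h (cartesianProduct xs ys)) ≡ sum (map (λ x → sum (map (λ y → h (x , y)) ys)) xs)
sum-cartesianProduct h [] ys = refl
sum-cartesianProduct h (x ∷ xs) ys = begin
  sum (map h (map (x ,_) ys ++ cartesianProduct xs ys))
    ≡⟨ cong sum (map-++ h (map (x ,_) ys) (cartesianProduct xs ys)) ⟩
  sum (map h (map (x ,_) ys) ++ map h (cartesianProduct xs ys))
    ≡⟨ sum-++ (map h (map (x ,_) ys)) _ ⟩
  sum (map h (map (x ,_) ys)) + sum (map h (cartesianProduct xs ys))
    ≡⟨ cong₂ _+_ (cong sum (sym (map-∘ ys))) (sum-cartesianProduct h xs ys) ⟩
  sum (map (λ y → h (x , y)) ys) + sum (map (λ x → sum (map (λ y → h (x , y)) ys)) xs)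
    ∎
  where open ≡-Reasoning

sum-map-*ˡ : ∀ {A : Set} q (h : A → ℕ) (xs : List A) →
  sum (map (λ x → q * h x) xs) ≡ q * sum (map h xs)
sum-map-*ˡ q h [] = sym (*-zeroʳ q)
sum-map-*ˡ q h (x ∷ xs) =
  trans (cong (q * h x +_) (sum-map-*ˡ q h xs)) (sym (*-distribˡ-+ q (h x) _))

map-∘toℕ-allFin : ∀ {A : Set} (h : ℕ → A) n → map (h ∘ toℕ) (allFin n) ≡ applyUpTo h n
map-∘toℕ-allFin h n = trans (map-tabulate id (h ∘ toℕ)) (tabulate-∘toℕ h n)
  where
  tabulate-∘toℕ : ∀ {A : Set} (h : ℕ → A) n → tabulate {n = n} (h ∘ toℕ) ≡ applyUpTo h n
  tabulate-∘toℕ h zero = refl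
  tabulate-∘toℕ h (suc n) = cong (h 0 ∷_) (tabulate-∘toℕ (h ∘ suc) n)

sum-applyUpTo-const : ∀ (h : ℕ → ℕ) {c} n → (∀ x → h x ≡ c) → sum (applyUpTo h n) ≡ n * c
sum-applyUpTo-const h zero _ = refl
sum-applyUpTo-const h (suc n) h≡c =
  cong₂ _+_ (h≡c 0) (sum-applyUpTo-const (h ∘ suc) n (h≡c ∘ suc))

sum-applyUpTo-residue₃ : ∀ (g : ℤ₃ → ℕ) q →
  sum (applyUpTo (g ∘ residue₃) (q * 3)) ≡ q * (g 0₃ + g 1₃ + g 2₃)
sum-applyUpTo-residue₃ g zero = refl
sum-applyUpTo-residue₃ g (suc q) = begin
  g 0₃ + (g 1₃ + (g 2₃ + sum (applyUpTo (g ∘ residue₃) (q * 3))))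
    ≡⟨ cong (λ s → g 0₃ + (g 1₃ + (g 2₃ + s))) (sum-applyUpTo-residue₃ g q) ⟩
  g 0₃ + (g 1₃ + (g 2₃ + q * (g 0₃ + g 1₃ + g 2₃)))
    ≡⟨ regroup (g 0₃) (g 1₃) (g 2₃) _ ⟩
  g 0₃ + g 1₃ + g 2₃ + q * (g 0₃ + g 1₃ + g 2₃)
    ∎
  where
  open ≡-Reasoning
  regroup : ∀ a b c x → a + (b + (c + x)) ≡ a + b + c + x
  regroup = solve-∀

∅ : Label
∅ = (false , false)

colour : Parity → Label
colour 0ℙ = (true , false)
colour 1ℙ = (false , true)

size-if-colour : ∀ b p → size (if b then colour p else ∅) ≡ indicator b
size-if-colour false _ = refl
size-if-colour true 0ℙ = refl
size-if-colour true 1ℙ = refl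

if-colour≡∅ : ∀ b p → (if b then colour p else ∅) ≡ ∅ → ¬ T b
if-colour≡∅ true 0ℙ () _
if-colour≡∅ true 1ℙ () _

if-T : ∀ {A : Set} {x y : A} b → T b → (if b then x else y) ≡ x
if-T true _ = refl

module _ (G : Graph) (f : Graph.V G → Label) where
  open Graph G

  RainbowDominated : V → Set
  RainbowDominated v =
    (∃[ u ] (Adj u v × has1 (f u) ≡ true)) × (∃[ u ] (Adj u v × has2 (f u) ≡ true))

  NeighbourLabelled : V → Label → Set
  NeighbourLabelled v ℓ = ∃[ u ] (Adj u v × f u ≡ ℓ)

  rainbow : ∀ {v} p → NeighbourLabelled v (colour p) → NeighbourLabelled v (colour (p ⁻¹)) →
            RainbowDominated v
  rainbow 0ℙ (u , u~v , fu) (w , w~v , fw) = (u , u~v , cong has1 fu) , (w , w~v , cong has2 fw)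
  rainbow 1ℙ (u , u~v , fu) (w , w~v , fw) = (w , w~v , cong has1 fw) , (u , u~v , cong has2 fu)

record CyclicCover (k : ℕ) : Set where
  field
    row          : Fin (suc k) → Subset₃
    row-nonempty : ∀ i → ∃[ a ] a ∈₃ row i
    row-covers   : ∀ i → Covers (row (prev i)) (row i) (row (next i))

module _ {k l : ℕ} (C : CyclicCover k) where
  open CyclicCover C

  labelling : Fin (suc k) × Fin (suc l) → Label
  labelling (i , j) = if row i (residue₃ (toℕ j)) then colour (parity (toℕ j)) else ∅

  labelling-is2RDF : 6 ∣ suc l → Is2RDF (CycleProd (suc k) (suc l)) labelling
  labelling-is2RDF 6∣n (i , j) empty = rainbow G labelling (parity (toℕ j)) vertical horizontal
    where
    G = CycleProd (suc k) (suc l)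
    3∣n = ∣-trans (divides 2 refl) 6∣n
    2∣n = ∣-trans (divides 3 refl) 6∣n

    a = residue₃ (toℕ j)

    a∉row : ¬ a ∈₃ row i
    a∉row = if-colour≡∅ (row i a) (parity (toℕ j)) empty

    labelled : ∀ i′ j′ → residue₃ (toℕ j′) ∈₃ row i′ →
               labelling (i′ , j′) ≡ colour (parity (toℕ j′))
    labelled i′ j′ = if-T (row i′ (residue₃ (toℕ j′)))

    vertical : NeighbourLabelled G labelling (i , j) (colour (parity (toℕ j)))
    vertical with row-covers i a
    ... | inj₁ a∈prev =
      (prev i , j) , inj₂ (refl , prev-adjacent i) , labelled (prev i) j a∈prev
    ... | inj₂ (inj₁ a∈row) = ⊥-elim (a∉row a∈row)
    ... | inj₂ (inj₂ a∈next) =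
      (next i , j) , inj₂ (refl , next-adjacent i) , labelled (next i) j a∈next

    horizontal : NeighbourLabelled G labelling (i , j) (colour (parity (toℕ j) ⁻¹))
    horizontal with row-nonempty i
    ... | b , b∈row with orbit-suc₃ (residue₃ (toℕ (prev j))) b
    ...   | inj₁ refl = (i , prev j) , inj₁ (refl , prev-adjacent j) ,
      trans (labelled i (prev j) b∈row) (cong colour (parity-prev 2∣n j))
    ...   | inj₂ (inj₁ refl) =
      ⊥-elim (a∉row (subst (_∈₃ row i) (sym (residue₃-prev 3∣n j)) b∈row))
    ...   | inj₂ (inj₂ refl) = (i , next j) , inj₁ (refl , next-adjacent j) ,
      trans (labelled i (next j) (subst (_∈₃ row i) b≡residue b∈row))
            (cong colour (parity-next 2∣n j))
      where
      b≡residue : suc₃ (suc₃ (residue₃ (toℕ (prev j)))) ≡ residue₃ (toℕ (next j))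
      b≡residue = trans (cong suc₃ (sym (residue₃-prev 3∣n j))) (sym (residue₃-next 3∣n j))

  weight-labelling : ∀ q → suc l ≡ q * 3 →
    weight (suc k) (suc l) labelling ≡ q * sum (map (∣_∣ ∘ row) (allFin (suc k)))
  weight-labelling q n≡q*3 = begin
    sum (map (size ∘ labelling) (cartesianProduct (allFin (suc k)) (allFin (suc l))))
      ≡⟨ sum-cartesianProduct (size ∘ labelling) (allFin (suc k)) (allFin (suc l)) ⟩
    sum (map (λ i → sum (map (λ j → size (labelling (i , j))) (allFin (suc l)))) (allFin (suc k)))
      ≡⟨ cong sum (map-cong row-weight (allFin (suc k))) ⟩
    sum (map (λ i → q * ∣ row i ∣) (allFin (suc k)))
      ≡⟨ sum-map-*ˡ q (∣_∣ ∘ row) (allFin (suc k)) ⟩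
    q * sum (map (∣_∣ ∘ row) (allFin (suc k)))
      ∎
    where
    open ≡-Reasoning
    row-weight : ∀ i → sum (map (λ j → size (labelling (i , j))) (allFin (suc l))) ≡ q * ∣ row i ∣
    row-weight i = begin
      sum (map (λ j → size (labelling (i , j))) (allFin (suc l)))
        ≡⟨ cong sum (map-cong size-labelling (allFin (suc l))) ⟩
      sum (map (g ∘ toℕ) (allFin (suc l)))
        ≡⟨ cong sum (map-∘toℕ-allFin g (suc l)) ⟩
      sum (applyUpTo g (suc l))
        ≡⟨ cong (sum ∘ applyUpTo g) n≡q*3 ⟩
      sum (applyUpTo g (q * 3))
        ≡⟨ sum-applyUpTo-residue₃ (indicator ∘ row i) q ⟩
      q * ∣ row i ∣
        ∎
      where
      g : ℕ → ℕ
      g = indicator ∘ row i ∘ residue₃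
      size-labelling : ∀ j → size (labelling (i , j)) ≡ g (toℕ j)
      size-labelling j = size-if-colour (row i (residue₃ (toℕ j))) (parity (toℕ j))

-- Row 0 also takes over the rows m, …, 3⌈m/3⌉ − 1 of the 3-periodic pattern, whose residues
-- are m mod 3, …, 2; the argument is m mod 3.
row₀ : ℤ₃ → Subset₃
row₀ 0₃ a = ⁅ 0₃ ⁆ a
row₀ 1₃ _ = true
row₀ 2₃ 1₃ = false
row₀ 2₃ _ = true

stripe : ℕ → ℕ → Subset₃
stripe m zero = row₀ (residue₃ m)
stripe m (suc x) = ⁅ residue₃ (suc x) ⁆

residue₃∈stripe : ∀ m x → residue₃ x ∈₃ stripe m x
residue₃∈stripe m zero = 0₃∈row₀ (residue₃ m)
  where
  0₃∈row₀ : ∀ s → 0₃ ∈₃ row₀ s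
  0₃∈row₀ 0₃ = _
  0₃∈row₀ 1₃ = _
  0₃∈row₀ 2₃ = _
residue₃∈stripe m (suc x) = ∈⁅⁆ (residue₃ (suc x))

stripe-consecutive : ∀ m x → Covers (stripe m x) (stripe m (suc x)) (stripe m (suc (suc x)))
stripe-consecutive m x = orbit-covers (residue₃ x) (residue₃∈stripe m x)
  (subst (_∈₃ stripe m (suc x)) (residue₃-suc x) (residue₃∈stripe m (suc x)))
  (subst (_∈₃ stripe m (suc (suc x))) (trans (residue₃-suc (suc x)) (cong suc₃ (residue₃-suc x)))
         (residue₃∈stripe m (suc (suc x))))

-- The rows at the seam depend on k only through k mod 3, so three evaluated cases suffice.
stripe-first : ∀ k → Covers (stripe (3 + k) (2 + k)) (stripe (3 + k) 0) (stripe (3 + k) 1)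
stripe-first 0 = covers?-sound _
stripe-first 1 = covers?-sound _
stripe-first 2 = covers?-sound _
stripe-first (suc (suc (suc k))) = stripe-first k

stripe-last : ∀ k → Covers (stripe (3 + k) (1 + k)) (stripe (3 + k) (2 + k)) (stripe (3 + k) 0)
stripe-last 0 = covers?-sound _
stripe-last 1 = covers?-sound _
stripe-last 2 = covers?-sound _
stripe-last (suc (suc (suc k))) = stripe-last k

stripe-covers : ∀ k (i : Fin (3 + k)) →
  Covers (stripe (3 + k) (toℕ (prev i))) (stripe (3 + k) (toℕ i)) (stripe (3 + k) (toℕ (next i)))
stripe-covers k zero = Covers-cong (stripe (3 + k))
  (toℕ-fromℕ (2 + k)) (refl {x = 0}) (toℕ-next-< {2 + k} zero (s≤s (s≤s z≤n)))
  (stripe-first k)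
stripe-covers k (suc i) with m≤n⇒m<n∨m≡n (toℕ<n (suc i))
... | inj₁ 2+i<m = Covers-cong (stripe (3 + k))
  (toℕ-inject₁ i) (refl {x = suc (toℕ i)}) (toℕ-next-< (suc i) 2+i<m)
  (stripe-consecutive (3 + k) (toℕ i))
... | inj₂ 2+i≡m = Covers-cong (stripe (3 + k))
  (trans (toℕ-inject₁ i) i≡1+k) (cong suc i≡1+k) (toℕ-next-last (suc i) 2+i≡m)
  (stripe-last k)
  where
  i≡1+k : toℕ i ≡ suc k
  i≡1+k = suc-injective (suc-injective 2+i≡m)

stripes : ∀ k → CyclicCover (2 + k)
stripes k = record
  { row          = stripe (3 + k) ∘ toℕ
  ; row-nonempty = λ i → residue₃ (toℕ i) , residue₃∈stripe (3 + k) (toℕ i)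
  ; row-covers   = stripe-covers k
  }

ceil3-3+ : ∀ x → ceil3 (3 + x) ≡ suc (ceil3 x)
ceil3-3+ x = +-distrib-/-∣ˡ {3} (x + 2) {3} ∣-refl

row₀-size : ∀ k → (2 + k) + ∣ row₀ (residue₃ k) ∣ ≡ 3 * ceil3 (3 + k)
row₀-size 0 = refl
row₀-size 1 = refl
row₀-size 2 = refl
row₀-size (suc (suc (suc k))) = begin
  3 + ((2 + k) + ∣ row₀ (residue₃ k) ∣)  ≡⟨ cong (3 +_) (row₀-size k) ⟩
  3 + 3 * ceil3 (3 + k)                  ≡⟨ sym (*-suc 3 (ceil3 (3 + k))) ⟩
  3 * suc (ceil3 (3 + k))                ≡⟨ cong (3 *_) (sym (ceil3-3+ (3 + k))) ⟩
  3 * ceil3 (6 + k)                      ∎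
  where open ≡-Reasoning

stripes-size : ∀ k →
  sum (map (∣_∣ ∘ CyclicCover.row (stripes k)) (allFin (3 + k))) ≡ 3 * ceil3 (3 + k)
stripes-size k = begin
  sum (map (∣_∣ ∘ stripe (3 + k) ∘ toℕ) (allFin (3 + k)))
    ≡⟨ cong sum (map-∘toℕ-allFin (∣_∣ ∘ stripe (3 + k)) (3 + k)) ⟩
  ∣ row₀ (residue₃ k) ∣ + sum (applyUpTo (∣_∣ ∘ stripe (3 + k) ∘ suc) (2 + k))
    ≡⟨ cong (∣ row₀ (residue₃ k) ∣ +_) (sum-applyUpTo-const _ (2 + k) (∣⁅⁆∣ ∘ residue₃ ∘ suc)) ⟩
  ∣ row₀ (residue₃ k) ∣ + (2 + k) * 1
    ≡⟨ cong (∣ row₀ (residue₃ k) ∣ +_) (*-identityʳ (2 + k)) ⟩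
  ∣ row₀ (residue₃ k) ∣ + (2 + k)
    ≡⟨ +-comm ∣ row₀ (residue₃ k) ∣ (2 + k) ⟩
  (2 + k) + ∣ row₀ (residue₃ k) ∣
    ≡⟨ row₀-size k ⟩
  3 * ceil3 (3 + k)
    ∎
  where open ≡-Reasoning

stripes-weight : ∀ k {l} → 3 ∣ suc l →
  weight (3 + k) (suc l) (labelling (stripes k)) ≡ ceil3 (3 + k) * suc l
stripes-weight k {l} (divides q n≡q*3) = begin
  weight (3 + k) (suc l) (labelling (stripes k))
    ≡⟨ weight-labelling (stripes k) q n≡q*3 ⟩
  q * sum (map (∣_∣ ∘ CyclicCover.row (stripes k)) (allFin (3 + k)))
    ≡⟨ cong (q *_) (stripes-size k) ⟩
  q * (3 * ceil3 (3 + k))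
    ≡⟨ regroup q (ceil3 (3 + k)) ⟩
  ceil3 (3 + k) * (q * 3)
    ≡⟨ cong (ceil3 (3 + k) *_) (sym n≡q*3) ⟩
  ceil3 (3 + k) * suc l
    ∎
  where
  open ≡-Reasoning
  regroup : ∀ q c → q * (3 * c) ≡ c * (q * 3)
  regroup = solve-∀

proposition4 : (m n : ℕ) → 6 ≤ n → n % 6 ≡ 0 → 3 ≤ m →
    (nzm : NonZero m) → (nzn : NonZero n) →
    γr2≤ m n {{nzm}} {{nzn}} (ceil3 m * n)
proposition4 (suc (suc (suc k))) (suc l) (s≤s _) n%6≡0 (s≤s (s≤s (s≤s _))) _ _ =
  labelling (stripes k) ,
  labelling-is2RDF (stripes k) 6∣n ,
  ≤-reflexive (stripes-weight k (∣-trans (divides 2 refl) 6∣n))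
  where
  6∣n : 6 ∣ suc l
  6∣n = m%n≡0⇒n∣m (suc l) 6 n%6≡0
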